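{- Let $w_1,w_2,w_3$ be positive integers and let $n\ge0$ be an integer. Then \begin{align*} &\sum_{k+\ell+m=n}\binom{n}{k,\ell,m}S_{k}(w_{1}-1)S_{\ell}(w_{2}-1)S_{m}(w_{3}-1)\,w_{3}^{k-1}w_{1}^{\ell-1}w_{2}^{m-1}\\ &=\sum_{k+\ell+m=n}\binom{n}{k,\ell,m}S_{k}(w_{1}-1)S_{\ell}(w_{3}-1)S_{m}(w_{2}-1)\,w_{2}^{k-1}w_{1}^{\ell-1}w_{3}^{m-1}. \end{align*}
   Context: For integers $k,N\ge0$, $S_k(N)=\sum_{i=0}^{N}i^k=0^k+1^k+\cdots+N^k$, with the convention $0^0=1$ (so $S_0(N)=N+1$ and $S_k(0)=0$ for $k>0$). Sums $\sum_{k+\ell+m=n}$ run over all nonnegative integers $k,\ell,m$ with $k+\ell+m=n$, and $\binom{n}{k,\ell,m}=\frac{n!}{k!\,\ell!\,m!}$. -}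

module Defs where

open import Data.Nat as ℕ using (ℕ; zero; suc; _∸_; NonZero; _!)
open import Data.Nat.Properties using (_!≢0; m*n≢0)
open import Data.Nat.ListAction using (sum)
open import Data.Integer using (+_)
open import Data.List using (List; map; upTo; foldr)
open import Data.Rational using (ℚ; _/_; _+_; _*_; 0ℚ; 1ℚ)

-- S k N = 0^k + 1^k + ... + N^k  (Agda's 0 ^ 0 = 1, matching the convention)
S : ℕ → ℕ → ℕ
S k N = sum (map (λ i → i ℕ.^ k) (upTo (suc N)))

sumℚ : List ℚ → ℚ
sumℚ = foldr _+_ 0ℚ

ℕ→ℚ : ℕ → ℚ
ℕ→ℚ n = (+ n) / 1

multinomial : ℕ → ℕ → ℕ → ℕ → ℚ
multinomial n k l m =
  ((+ (n !)) / ((k ! ℕ.* l !) ℕ.* m !))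
    {{m*n≢0 (k ! ℕ.* l !) (m !) {{m*n≢0 (k !) (l !) {{k !≢0}} {{l !≢0}}}} {{m !≢0}}}}

-- w ^ (k - 1) in ℚ, for w ≠ 0 (so k = 0 gives 1/w)
powPred : (w : ℕ) → .{{NonZero w}} → ℕ → ℚ
powPred w zero = (+ 1) / w
powPred w (suc k) = ℕ→ℚ (w ℕ.^ k)

sumTriples : ℕ → (ℕ → ℕ → ℕ → ℚ) → ℚ
sumTriples n f =
  sumℚ (map (λ k → sumℚ (map (λ l → f k l (n ∸ k ∸ l)) (upTo (suc (n ∸ k))))) (upTo (suc n)))

{-# OPTIONS --safe #-}
-- Multiplying both sides by w₁w₂w₃ turns every w^(k-1) into w^k.  Writing P(a, d) for the
-- multiset {0, d, …, (a-1)d}, S_k(a-1) d^k is the k-th power sum of P(a, d), so by the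
-- multinomial theorem the left side becomes the n-th power sum of the sumset
-- P(w₁,w₃) + P(w₂,w₁) + P(w₃,w₂), and the right side that of P(w₁,w₂) + P(w₃,w₁) + P(w₂,w₃).
-- As multisets P(b, a) + [0, a) = [0, ab) = P(a, b) + [0, b), so after adding [0, w₃) the
-- three progressions can be traded one by one for the other three.
-- Power sums of a sumset are binomial convolutions of the power sums of its summands, and this
-- lets the summand [0, w₃) be cancelled again by strong induction on the exponent.
module Submission where

open import Defs

open import Level using (Level; 0ℓ)
open import Algebra.Bundles using (CommutativeMonoid; CommutativeSemiring)
open import Data.Fin using (toℕ)
open import Data.List using (List; []; _∷_; [_]; _++_; map; foldr; length; upTo; cartesianProductWith)
open import Data.List.Membership.Propositional using (_∈_)
open import Data.List.Membership.Propositional.Properties using (∈-upTo⁻)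
open import Data.List.Properties using (map-∘; map-upTo; upTo-∷ʳ; length-upTo)
open import Data.List.Relation.Unary.Any using (here; there)
import Data.Nat as ℕ
open ℕ using (ℕ; zero; suc; NonZero)
import Data.Nat.Properties as ℕₚ
open import Data.Nat.Combinatorics using (_C_; nCn≡1)
open import Data.Nat.Induction using (<-rec)
import Algebra.Properties.Semiring.Exp
import Algebra.Properties.Monoid.Mult
import Algebra.Properties.CommutativeSemiring.Binomial
import Algebra.Properties.CommutativeSemiring.Exp
import Algebra.Solver.CommutativeMonoid
open import Algebra.Structures.Biased using (isCommutativeMonoidˡ)
open import Relation.Binary.Structures using (IsEquivalence)
open import Function using (_∘_)
import Relation.Binary.PropositionalEquality as ≡
import Relation.Binary.Reasoning.Setoid
open ≡ using (_≡_)

module ListSum {c ℓ} (R : CommutativeSemiring c ℓ) where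

  open CommutativeSemiring R
  open import Algebra.Definitions.RawMonoid +-rawMonoid using (sum)
  open import Relation.Binary.Reasoning.Setoid setoid

  private variable
    a b : Level
    A : Set a
    B : Set b

  Σ : (A → Carrier) → List A → Carrier
  Σ g xs = foldr _+_ 0# (map g xs)

  Σ-cong-∈ : ∀ {g h : A → Carrier} xs → (∀ {x} → x ∈ xs → g x ≈ h x) → Σ g xs ≈ Σ h xs
  Σ-cong-∈ []       g≈h = refl
  Σ-cong-∈ (x ∷ xs) g≈h = +-cong (g≈h (here ≡.refl)) (Σ-cong-∈ xs (g≈h ∘ there))

  Σ-cong : ∀ {g h : A → Carrier} xs → (∀ x → g x ≈ h x) → Σ g xs ≈ Σ h xs
  Σ-cong xs g≈h = Σ-cong-∈ xs (λ {x} _ → g≈h x)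

  Σ-map : ∀ (g : B → Carrier) (f : A → B) xs → Σ g (map f xs) ≡ Σ (g ∘ f) xs
  Σ-map g f xs = ≡.cong (foldr _+_ 0#) (≡.sym (map-∘ xs))

  Σ-++ : ∀ (g : A → Carrier) xs ys → Σ g (xs ++ ys) ≈ Σ g xs + Σ g ys
  Σ-++ g []       ys = sym (+-identityˡ _)
  Σ-++ g (x ∷ xs) ys = trans (+-congˡ (Σ-++ g xs ys)) (sym (+-assoc _ _ _))

  Σ-0# : ∀ xs → Σ (λ (_ : A) → 0#) xs ≈ 0#
  Σ-0# []       = refl
  Σ-0# (x ∷ xs) = trans (+-congˡ (Σ-0# xs)) (+-identityˡ 0#)

  Σ-+ : ∀ (g h : A → Carrier) xs → Σ (λ x → g x + h x) xs ≈ Σ g xs + Σ h xs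
  Σ-+ g h []       = sym (+-identityˡ 0#)
  Σ-+ g h (x ∷ xs) = trans (+-congˡ (Σ-+ g h xs)) (interchange _ _ _ _)
    where open import Algebra.Properties.CommutativeSemigroup +-commutativeSemigroup using (interchange)

  Σ-*ˡ : ∀ r (g : A → Carrier) xs → Σ (λ x → r * g x) xs ≈ r * Σ g xs
  Σ-*ˡ r g []       = sym (zeroʳ r)
  Σ-*ˡ r g (x ∷ xs) = trans (+-congˡ (Σ-*ˡ r g xs)) (sym (distribˡ r _ _))

  Σ-*ʳ : ∀ r (g : A → Carrier) xs → Σ (λ x → g x * r) xs ≈ Σ g xs * r
  Σ-*ʳ r g xs = trans (Σ-cong xs (λ x → *-comm (g x) r)) (trans (Σ-*ˡ r g xs) (*-comm r _))

  Σ-*-Σ : ∀ (f : A → Carrier) (g : B → Carrier) xs ys →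
          Σ (λ x → Σ (λ y → f x * g y) ys) xs ≈ Σ f xs * Σ g ys
  Σ-*-Σ f g xs ys = trans (Σ-cong xs (λ x → Σ-*ˡ (f x) g ys)) (Σ-*ʳ (Σ g ys) f xs)

  Σ-swap : ∀ (f : A → B → Carrier) xs ys →
           Σ (λ x → Σ (f x) ys) xs ≈ Σ (λ y → Σ (λ x → f x y) xs) ys
  Σ-swap f []       ys = sym (Σ-0# ys)
  Σ-swap f (x ∷ xs) ys =
    trans (+-congˡ (Σ-swap f xs ys)) (sym (Σ-+ (f x) (λ y → Σ (λ x → f x y) xs) ys))

  Σ-cong-upTo : ∀ {g h : ℕ → Carrier} n → (∀ {i} → i ℕ.< n → g i ≈ h i) → Σ g (upTo n) ≈ Σ h (upTo n)
  Σ-cong-upTo n g≈h = Σ-cong-∈ (upTo n) (g≈h ∘ ∈-upTo⁻)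

  Σ-upTo-suc : ∀ (g : ℕ → Carrier) n → Σ g (upTo (suc n)) ≡ g 0 + Σ (g ∘ suc) (upTo n)
  Σ-upTo-suc g n = ≡.trans (≡.cong (λ is → g 0 + Σ g is) (≡.sym (map-upTo suc n)))
                           (≡.cong (g 0 +_) (Σ-map g suc (upTo n)))

  Σ-upTo-sucʳ : ∀ (g : ℕ → Carrier) n → Σ g (upTo (suc n)) ≈ Σ g (upTo n) + g n
  Σ-upTo-sucʳ g n = begin
    Σ g (upTo (suc n))        ≡⟨ ≡.cong (Σ g) (upTo-∷ʳ n) ⟨
    Σ g (upTo n ++ [ n ])     ≈⟨ Σ-++ g (upTo n) [ n ] ⟩
    Σ g (upTo n) + (g n + 0#) ≈⟨ +-congˡ (+-identityʳ (g n)) ⟩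
    Σ g (upTo n) + g n        ∎

  Σ-upTo-+ : ∀ (g : ℕ → Carrier) m n →
             Σ g (upTo (m ℕ.+ n)) ≈ Σ g (upTo m) + Σ (λ j → g (m ℕ.+ j)) (upTo n)
  Σ-upTo-+ g zero    n = sym (+-identityˡ _)
  Σ-upTo-+ g (suc m) n = begin
    Σ g (upTo (suc m ℕ.+ n))                      ≡⟨ Σ-upTo-suc g (m ℕ.+ n) ⟩
    g 0 + Σ (g ∘ suc) (upTo (m ℕ.+ n))            ≈⟨ +-congˡ (Σ-upTo-+ (g ∘ suc) m n) ⟩
    g 0 + (Σ (g ∘ suc) (upTo m) + tail)           ≈⟨ +-assoc (g 0) (Σ (g ∘ suc) (upTo m)) tail ⟨
    (g 0 + Σ (g ∘ suc) (upTo m)) + tail           ≡⟨ ≡.cong (_+ tail) (Σ-upTo-suc g m) ⟨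
    Σ g (upTo (suc m)) + tail                     ∎
    where tail = Σ (λ j → g (suc m ℕ.+ j)) (upTo n)

  Σ-upTo-* : ∀ (g : ℕ → Carrier) b a →
             Σ g (upTo (b ℕ.* a)) ≈ Σ (λ i → Σ (λ j → g (i ℕ.* a ℕ.+ j)) (upTo a)) (upTo b)
  Σ-upTo-* g zero    a = refl
  Σ-upTo-* g (suc b) a = begin
    Σ g (upTo (a ℕ.+ b ℕ.* a))
      ≈⟨ Σ-upTo-+ g a (b ℕ.* a) ⟩
    Σ g (upTo a) + Σ (λ t → g (a ℕ.+ t)) (upTo (b ℕ.* a))
      ≈⟨ +-congˡ (Σ-upTo-* (λ t → g (a ℕ.+ t)) b a) ⟩
    Σ g (upTo a) + Σ (λ i → Σ (λ j → g (a ℕ.+ (i ℕ.* a ℕ.+ j))) (upTo a)) (upTo b)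
      ≈⟨ +-congˡ (Σ-cong (upTo b) λ i → Σ-cong (upTo a) λ j →
                    reflexive (≡.cong g (≡.sym (ℕₚ.+-assoc a (i ℕ.* a) j)))) ⟩
    Σ g (upTo a) + Σ (λ i → Σ (λ j → g (suc i ℕ.* a ℕ.+ j)) (upTo a)) (upTo b)
      ≡⟨ Σ-upTo-suc (λ i → Σ (λ j → g (i ℕ.* a ℕ.+ j)) (upTo a)) b ⟨
    Σ (λ i → Σ (λ j → g (i ℕ.* a ℕ.+ j)) (upTo a)) (upTo (suc b))
      ∎

  Σ-upTo-sum : ∀ (g : ℕ → Carrier) n → Σ g (upTo n) ≡ sum {n} (g ∘ toℕ)
  Σ-upTo-sum g zero    = ≡.refl
  Σ-upTo-sum g (suc n) = ≡.trans (Σ-upTo-suc g n) (≡.cong (g 0 +_) (Σ-upTo-sum (g ∘ suc) n))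

module PowerSums where

  open import Data.Nat using (ℕ; zero; suc; _+_; _*_; _^_; _∸_; _<_; NonZero)
  open import Data.Nat.Properties
  open ListSum +-*-commutativeSemiring
  open ≡ using (refl; sym; trans; cong; cong₂; _≗_)

  private
    module Exp = Algebra.Properties.Semiring.Exp +-*-semiring
    module Mult = Algebra.Properties.Monoid.Mult +-0-monoid
    module Binomial = Algebra.Properties.CommutativeSemiring.Binomial +-*-commutativeSemiring

  ^-semiring≡^ : ∀ x n → x Exp.^ n ≡ x ^ n
  ^-semiring≡^ x zero    = refl
  ^-semiring≡^ x (suc n) = cong (x *_) (^-semiring≡^ x n)

  ×-monoid≡* : ∀ n x → n Mult.× x ≡ n * x
  ×-monoid≡* zero    x = refl
  ×-monoid≡* (suc n) x = cong (x +_) (×-monoid≡* n x)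

  +-^-binomial : ∀ n x y → (x + y) ^ n ≡ Σ (λ k → (n C k) * (x ^ k * y ^ (n ∸ k))) (upTo (suc n))
  +-^-binomial n x y = begin
    (x + y) ^ n                      ≡⟨ ^-semiring≡^ (x + y) n ⟨
    (x + y) Exp.^ n                  ≡⟨ Binomial.theorem n x y ⟩
    Binomial.binomialExpansion x y n ≡⟨ Σ-upTo-sum _ (suc n) ⟨
    Σ (λ k → (n C k) Mult.× (x Exp.^ k * y Exp.^ (n ∸ k))) (upTo (suc n))
      ≡⟨ Σ-cong (upTo (suc n)) (λ k → trans (×-monoid≡* (n C k) _)
           (cong ((n C k) *_) (cong₂ _*_ (^-semiring≡^ x k) (^-semiring≡^ y (n ∸ k))))) ⟩
    Σ (λ k → (n C k) * (x ^ k * y ^ (n ∸ k))) (upTo (suc n)) ∎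
    where open ≡.≡-Reasoning

  ^-distribʳ-* : ∀ x y n → (x * y) ^ n ≡ x ^ n * y ^ n
  ^-distribʳ-* x y n = begin
    (x * y) ^ n             ≡⟨ ^-semiring≡^ (x * y) n ⟨
    (x * y) Exp.^ n         ≡⟨ CSExp.^-distrib-* x y n ⟩
    x Exp.^ n * y Exp.^ n   ≡⟨ cong₂ _*_ (^-semiring≡^ x n) (^-semiring≡^ y n) ⟩
    x ^ n * y ^ n           ∎
    where
    open ≡.≡-Reasoning
    module CSExp = Algebra.Properties.CommutativeSemiring.Exp +-*-commutativeSemiring

  infixr 6 _⊕_
  _⊕_ : List ℕ → List ℕ → List ℕ
  _⊕_ = cartesianProductWith _+_

  Σ-⊕ : ∀ g xs ys → Σ g (xs ⊕ ys) ≡ Σ (λ x → Σ (λ y → g (x + y)) ys) xs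
  Σ-⊕ g []       ys = refl
  Σ-⊕ g (x ∷ xs) ys =
    trans (Σ-++ g (map (x +_) ys) (xs ⊕ ys)) (cong₂ _+_ (Σ-map g (x +_) ys) (Σ-⊕ g xs ys))

  -- Equality of multisets: a natural-valued sum cannot tell the two lists apart.
  infix 4 _≋_
  record _≋_ (xs ys : List ℕ) : Set where
    constructor mk≋
    field Σ-≋ : ∀ g → Σ g xs ≡ Σ g ys
  open _≋_

  ≋-refl : ∀ {xs} → xs ≋ xs
  ≋-refl = mk≋ λ _ → refl

  ≋-isEquivalence : IsEquivalence _≋_
  ≋-isEquivalence = record
    { refl  = ≋-refl
    ; sym   = λ xs≋ys → mk≋ λ g → sym (Σ-≋ xs≋ys g)
    ; trans = λ xs≋ys ys≋zs → mk≋ λ g → trans (Σ-≋ xs≋ys g) (Σ-≋ ys≋zs g)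
    }

  ⊕-cong : ∀ {xs xs′ ys ys′} → xs ≋ xs′ → ys ≋ ys′ → xs ⊕ ys ≋ xs′ ⊕ ys′
  ⊕-cong {xs} {xs′} {ys} {ys′} xs≋xs′ ys≋ys′ = mk≋ λ g → begin
    Σ g (xs ⊕ ys)                            ≡⟨ Σ-⊕ g xs ys ⟩
    Σ (λ x → Σ (λ y → g (x + y)) ys) xs      ≡⟨ Σ-cong xs (λ x → Σ-≋ ys≋ys′ (λ y → g (x + y))) ⟩
    Σ (λ x → Σ (λ y → g (x + y)) ys′) xs     ≡⟨ Σ-≋ xs≋xs′ _ ⟩
    Σ (λ x → Σ (λ y → g (x + y)) ys′) xs′    ≡⟨ Σ-⊕ g xs′ ys′ ⟨
    Σ g (xs′ ⊕ ys′)                          ∎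
    where open ≡.≡-Reasoning

  ⊕-comm : ∀ xs ys → xs ⊕ ys ≋ ys ⊕ xs
  ⊕-comm xs ys = mk≋ λ g → begin
    Σ g (xs ⊕ ys)                       ≡⟨ Σ-⊕ g xs ys ⟩
    Σ (λ x → Σ (λ y → g (x + y)) ys) xs ≡⟨ Σ-swap (λ x y → g (x + y)) xs ys ⟩
    Σ (λ y → Σ (λ x → g (x + y)) xs) ys ≡⟨ Σ-cong ys (λ y → Σ-cong xs (λ x → cong g (+-comm x y))) ⟩
    Σ (λ y → Σ (λ x → g (y + x)) xs) ys ≡⟨ Σ-⊕ g ys xs ⟨
    Σ g (ys ⊕ xs)                       ∎
    where open ≡.≡-Reasoning

  ⊕-assoc : ∀ xs ys zs → (xs ⊕ ys) ⊕ zs ≋ xs ⊕ (ys ⊕ zs)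
  ⊕-assoc xs ys zs = mk≋ λ g → begin
    Σ g ((xs ⊕ ys) ⊕ zs)                                       ≡⟨ Σ-⊕ g (xs ⊕ ys) zs ⟩
    Σ (λ t → Σ (λ z → g (t + z)) zs) (xs ⊕ ys)                 ≡⟨ Σ-⊕ _ xs ys ⟩
    Σ (λ x → Σ (λ y → Σ (λ z → g (x + y + z)) zs) ys) xs
      ≡⟨ Σ-cong xs (λ x → Σ-cong ys (λ y → Σ-cong zs (λ z → cong g (+-assoc x y z)))) ⟩
    Σ (λ x → Σ (λ y → Σ (λ z → g (x + (y + z))) zs) ys) xs     ≡⟨ Σ-cong xs (λ x → Σ-⊕ (λ t → g (x + t)) ys zs) ⟨
    Σ (λ x → Σ (λ t → g (x + t)) (ys ⊕ zs)) xs                 ≡⟨ Σ-⊕ g xs (ys ⊕ zs) ⟨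
    Σ g (xs ⊕ (ys ⊕ zs))                                       ∎
    where open ≡.≡-Reasoning

  ⊕-identityˡ : ∀ xs → [ 0 ] ⊕ xs ≋ xs
  ⊕-identityˡ xs = mk≋ λ g → trans (Σ-⊕ g [ 0 ] xs) (+-identityʳ (Σ g xs))

  ⊕-commutativeMonoid : CommutativeMonoid 0ℓ 0ℓ
  ⊕-commutativeMonoid = record
    { Carrier = List ℕ
    ; _≈_     = _≋_
    ; _∙_     = _⊕_
    ; ε       = [ 0 ]
    ; isCommutativeMonoid = isCommutativeMonoidˡ record
      { isSemigroup = record
        { isMagma = record { isEquivalence = ≋-isEquivalence ; ∙-cong = ⊕-cong }
        ; assoc   = ⊕-assoc
        }
      ; identityˡ = ⊕-identityˡ
      ; comm      = ⊕-comm
      }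
    }

  powerSum : List ℕ → ℕ → ℕ
  powerSum xs k = Σ (_^ k) xs

  powerSum-zero : ∀ xs → powerSum xs 0 ≡ length xs
  powerSum-zero []       = refl
  powerSum-zero (x ∷ xs) = cong suc (powerSum-zero xs)

  powerSum-≋ : ∀ {xs ys} → xs ≋ ys → powerSum xs ≗ powerSum ys
  powerSum-≋ xs≋ys k = Σ-≋ xs≋ys (_^ k)

  infixr 7 _⋆_
  _⋆_ : (ℕ → ℕ) → (ℕ → ℕ) → ℕ → ℕ
  (a ⋆ b) n = Σ (λ k → (n C k) * a k * b (n ∸ k)) (upTo (suc n))

  ⋆-cong : ∀ {a a′ b b′} → a ≗ a′ → b ≗ b′ → a ⋆ b ≗ a′ ⋆ b′
  ⋆-cong a≗a′ b≗b′ n =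
    Σ-cong (upTo (suc n)) (λ k → cong₂ (λ u v → (n C k) * u * v) (a≗a′ k) (b≗b′ (n ∸ k)))

  ⋆-last : ∀ a b n → (a ⋆ b) n ≡ Σ (λ k → (n C k) * a k * b (n ∸ k)) (upTo n) + a n * b 0
  ⋆-last a b n = trans (Σ-upTo-sucʳ term n) (cong (Σ term (upTo n) +_) last-term)
    where
    term : ℕ → ℕ
    term k = (n C k) * a k * b (n ∸ k)
    last-term : term n ≡ a n * b 0
    last-term rewrite nCn≡1 n | n∸n≡0 n = cong (_* b 0) (+-identityʳ (a n))

  powerSum-⊕ : ∀ xs ys → powerSum (xs ⊕ ys) ≗ powerSum xs ⋆ powerSum ys
  powerSum-⊕ xs ys n = begin
    powerSum (xs ⊕ ys) n
      ≡⟨ Σ-⊕ (_^ n) xs ys ⟩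
    Σ (λ x → Σ (λ y → (x + y) ^ n) ys) xs
      ≡⟨ Σ-cong xs (λ x → Σ-cong ys (λ y → +-^-binomial n x y)) ⟩
    Σ (λ x → Σ (λ y → Σ (term x y) (upTo (suc n))) ys) xs
      ≡⟨ Σ-cong xs (λ x → Σ-swap (term x) ys (upTo (suc n))) ⟩
    Σ (λ x → Σ (λ k → Σ (λ y → term x y k) ys) (upTo (suc n))) xs
      ≡⟨ Σ-swap (λ x k → Σ (λ y → term x y k) ys) xs (upTo (suc n)) ⟩
    Σ (λ k → Σ (λ x → Σ (λ y → term x y k) ys) xs) (upTo (suc n))
      ≡⟨ Σ-cong (upTo (suc n)) separate ⟩
    (powerSum xs ⋆ powerSum ys) n ∎
    where
    open ≡.≡-Reasoning
    term : ℕ → ℕ → ℕ → ℕ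
    term x y k = (n C k) * (x ^ k * y ^ (n ∸ k))
    separate : ∀ k → Σ (λ x → Σ (λ y → term x y k) ys) xs ≡ (n C k) * powerSum xs k * powerSum ys (n ∸ k)
    separate k = begin
      Σ (λ x → Σ (λ y → (n C k) * (x ^ k * y ^ (n ∸ k))) ys) xs
        ≡⟨ Σ-cong xs (λ x → Σ-cong ys (λ y → *-assoc (n C k) (x ^ k) (y ^ (n ∸ k)))) ⟨
      Σ (λ x → Σ (λ y → (n C k) * x ^ k * y ^ (n ∸ k)) ys) xs
        ≡⟨ Σ-*-Σ (λ x → (n C k) * x ^ k) (_^ (n ∸ k)) xs ys ⟩
      Σ (λ x → (n C k) * x ^ k) xs * powerSum ys (n ∸ k)
        ≡⟨ cong (_* powerSum ys (n ∸ k)) (Σ-*ˡ (n C k) (_^ k) xs) ⟩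
      (n C k) * powerSum xs k * powerSum ys (n ∸ k) ∎

  powerSum-⊕³ : ∀ xs ys zs → powerSum (xs ⊕ ys ⊕ zs) ≗ powerSum xs ⋆ powerSum ys ⋆ powerSum zs
  powerSum-⊕³ xs ys zs n = trans (powerSum-⊕ xs (ys ⊕ zs) n) (⋆-cong (λ _ → refl) (powerSum-⊕ ys zs) n)

  -- In the convolution for xs ⊕ zs the exponent n of xs occurs only in the top term
  -- powerSum xs n * length zs, so strong induction on n applies.
  powerSum-cancelʳ : ∀ xs ys zs .{{_ : NonZero (length zs)}} →
    powerSum (xs ⊕ zs) ≗ powerSum (ys ⊕ zs) → powerSum xs ≗ powerSum ys
  powerSum-cancelʳ xs ys zs eq = <-rec _ step
    where
    p = powerSum
    lower : List ℕ → ℕ → ℕ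
    lower ws n = Σ (λ k → (n C k) * p ws k * p zs (n ∸ k)) (upTo n)
    step : ∀ n → (∀ {k} → k < n → p xs k ≡ p ys k) → p xs n ≡ p ys n
    step n ih = *-cancelʳ-≡ (p xs n) (p ys n) (length zs) (+-cancelˡ-≡ (lower ys n) _ _ (begin
      lower ys n + p xs n * length zs ≡⟨ cong₂ (λ u v → u + p xs n * v) lower-eq (powerSum-zero zs) ⟨
      lower xs n + p xs n * p zs 0    ≡⟨ ⋆-last (p xs) (p zs) n ⟨
      (p xs ⋆ p zs) n                 ≡⟨ powerSum-⊕ xs zs n ⟨
      p (xs ⊕ zs) n                   ≡⟨ eq n ⟩
      p (ys ⊕ zs) n                   ≡⟨ powerSum-⊕ ys zs n ⟩
      (p ys ⋆ p zs) n                 ≡⟨ ⋆-last (p ys) (p zs) n ⟩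
      lower ys n + p ys n * p zs 0    ≡⟨ cong (λ v → lower ys n + p ys n * v) (powerSum-zero zs) ⟩
      lower ys n + p ys n * length zs ∎))
      where
      open ≡.≡-Reasoning
      lower-eq : lower xs n ≡ lower ys n
      lower-eq = Σ-cong-upTo n (λ {k} k<n → cong (λ u → (n C k) * u * p zs (n ∸ k)) (ih k<n))

  progression : ℕ → ℕ → List ℕ
  progression n d = map (_* d) (upTo n)

  powerSum-progression : ∀ n d → powerSum (progression n d) ≗ λ k → powerSum (upTo n) k * d ^ k
  powerSum-progression n d k = begin
    powerSum (progression n d) k     ≡⟨ Σ-map (_^ k) (_* d) (upTo n) ⟩
    Σ (λ i → (i * d) ^ k) (upTo n)   ≡⟨ Σ-cong (upTo n) (λ i → ^-distribʳ-* i d k) ⟩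
    Σ (λ i → i ^ k * d ^ k) (upTo n) ≡⟨ Σ-*ʳ (d ^ k) (_^ k) (upTo n) ⟩
    powerSum (upTo n) k * d ^ k      ∎
    where open ≡.≡-Reasoning

  -- Every t < b * a is i * a + j for exactly one i < b and j < a.
  progression-⊕-upTo : ∀ b a → progression b a ⊕ upTo a ≋ upTo (b * a)
  progression-⊕-upTo b a = mk≋ λ g → begin
    Σ g (progression b a ⊕ upTo a)                           ≡⟨ Σ-⊕ g (progression b a) (upTo a) ⟩
    Σ (λ x → Σ (λ j → g (x + j)) (upTo a)) (progression b a) ≡⟨ Σ-map _ (_* a) (upTo b) ⟩
    Σ (λ i → Σ (λ j → g (i * a + j)) (upTo a)) (upTo b)      ≡⟨ Σ-upTo-* g b a ⟨
    Σ g (upTo (b * a))                                       ∎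
    where open ≡.≡-Reasoning

  progression-swap : ∀ a b → progression b a ⊕ upTo a ≋ progression a b ⊕ upTo b
  progression-swap a b = mk≋ λ g → begin
    Σ g (progression b a ⊕ upTo a) ≡⟨ Σ-≋ (progression-⊕-upTo b a) g ⟩
    Σ g (upTo (b * a))             ≡⟨ cong (Σ g ∘ upTo) (*-comm b a) ⟩
    Σ g (upTo (a * b))             ≡⟨ Σ-≋ (progression-⊕-upTo a b) g ⟨
    Σ g (progression a b ⊕ upTo b) ∎
    where open ≡.≡-Reasoning

  -- Both sumsets have generating function
  -- (1 - t^ab)(1 - t^bc)(1 - t^ca) / ((1 - t^a)(1 - t^b)(1 - t^c));
  -- adjoining upTo c lets progression-swap move one factor of the denominator at a time.
  progressions-⊕-≋ : ∀ a b c →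
    (progression a c ⊕ progression b a ⊕ progression c b) ⊕ upTo c
      ≋ (progression a b ⊕ progression c a ⊕ progression b c) ⊕ upTo c
  progressions-⊕-≋ a b c = begin
    (P a c ⊕ P b a ⊕ P c b) ⊕ upTo c ≈⟨ solve 4 (λ x y z t → (x ⊕′ y ⊕′ z) ⊕′ t ⊜ y ⊕′ z ⊕′ x ⊕′ t) ≋-refl
                                          (P a c) (P b a) (P c b) (upTo c) ⟩
    P b a ⊕ P c b ⊕ P a c ⊕ upTo c   ≈⟨ trade (P b a) (P c b) (progression-swap c a) ⟩
    P b a ⊕ P c b ⊕ P c a ⊕ upTo a   ≈⟨ rotate (P b a) (P c b) (P c a) (upTo a) ⟩
    P c b ⊕ P c a ⊕ P b a ⊕ upTo a   ≈⟨ trade (P c b) (P c a) (progression-swap a b) ⟩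
    P c b ⊕ P c a ⊕ P a b ⊕ upTo b   ≈⟨ rotate (P c b) (P c a) (P a b) (upTo b) ⟩
    P c a ⊕ P a b ⊕ P c b ⊕ upTo b   ≈⟨ trade (P c a) (P a b) (progression-swap b c) ⟩
    P c a ⊕ P a b ⊕ P b c ⊕ upTo c   ≈⟨ solve 4 (λ x y z t → x ⊕′ y ⊕′ z ⊕′ t ⊜ (y ⊕′ x ⊕′ z) ⊕′ t) ≋-refl
                                          (P c a) (P a b) (P b c) (upTo c) ⟩
    (P a b ⊕ P c a ⊕ P b c) ⊕ upTo c ∎
    where
    P = progression
    open Algebra.Solver.CommutativeMonoid ⊕-commutativeMonoid using (solve; _⊜_) renaming (_⊕_ to _⊕′_)
    open Relation.Binary.Reasoning.Setoid (CommutativeMonoid.setoid ⊕-commutativeMonoid)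
    rotate : ∀ x y z t → x ⊕ y ⊕ z ⊕ t ≋ y ⊕ z ⊕ x ⊕ t
    rotate = solve 4 (λ x y z t → x ⊕′ y ⊕′ z ⊕′ t ⊜ y ⊕′ z ⊕′ x ⊕′ t) ≋-refl
    trade : ∀ x y {zs zs′} → zs ≋ zs′ → x ⊕ y ⊕ zs ≋ x ⊕ y ⊕ zs′
    trade x y zs≋zs′ = ⊕-cong (≋-refl {x}) (⊕-cong (≋-refl {y}) zs≋zs′)

  powerSum-progressions : ∀ a b c .{{_ : NonZero c}} →
    powerSum (progression a c ⊕ progression b a ⊕ progression c b)
      ≗ powerSum (progression a b ⊕ progression c a ⊕ progression b c)
  powerSum-progressions a b c {{c≢0}} =
    powerSum-cancelʳ (progression a c ⊕ progression b a ⊕ progression c b)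
      (progression a b ⊕ progression c a ⊕ progression b c) (upTo c)
      {{≡.subst NonZero (sym (length-upTo c)) c≢0}}
      (powerSum-≋ (progressions-⊕-≋ a b c))

  progressions-⋆ : ∀ a b c .{{_ : NonZero c}} →
    (λ k → powerSum (upTo a) k * c ^ k) ⋆ (λ k → powerSum (upTo b) k * a ^ k) ⋆ (λ k → powerSum (upTo c) k * b ^ k)
      ≗ (λ k → powerSum (upTo a) k * b ^ k) ⋆ (λ k → powerSum (upTo c) k * a ^ k) ⋆ (λ k → powerSum (upTo b) k * c ^ k)
  progressions-⋆ a b c n = begin
    _                                                ≡⟨ ⋆-cong (p a c) (⋆-cong (p b a) (p c b)) n ⟨
    (powerSum (P a c) ⋆ powerSum (P b a) ⋆ powerSum (P c b)) n ≡⟨ powerSum-⊕³ (P a c) (P b a) (P c b) n ⟨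
    powerSum (P a c ⊕ P b a ⊕ P c b) n                ≡⟨ powerSum-progressions a b c n ⟩
    powerSum (P a b ⊕ P c a ⊕ P b c) n                ≡⟨ powerSum-⊕³ (P a b) (P c a) (P b c) n ⟩
    (powerSum (P a b) ⋆ powerSum (P c a) ⋆ powerSum (P b c)) n ≡⟨ ⋆-cong (p a b) (⋆-cong (p c a) (p b c)) n ⟩
    _                                                ∎
    where
    open ≡.≡-Reasoning
    P = progression
    p = powerSum-progression

open import Algebra.Bundles using (CommutativeRing)
import Data.Integer as ℤ
import Data.Integer.Properties as ℤₚ
open import Data.Nat using (_∸_; _!)
open import Data.Nat.Combinatorics using (nCk≡n!/k![n-k]!; k![n∸k]!∣n!)
open import Data.Nat.Coprimality using (1-coprimeTo) renaming (sym to coprime-sym)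
open import Data.Nat.DivMod using (m/n*n≡m)
open import Data.Rational using (ℚ; mkℚ; _/_; _+_; _*_; 1ℚ)
import Data.Rational.Properties as ℚₚ
open import Data.Rational.Solver using (module +-*-Solver)
open import Data.Rational.Unnormalised.Base using (mkℚᵘ; *≡*)
open ≡ using (refl; sym; trans; cong; cong₂)

open PowerSums
module ℕΣ = ListSum ℕₚ.+-*-commutativeSemiring
module ℚΣ = ListSum (CommutativeRing.commutativeSemiring ℚₚ.+-*-commutativeRing)

ℕ→ℚ-mkℚ : ∀ n → ℕ→ℚ n ≡ mkℚ (ℤ.+ n) 0 (coprime-sym (1-coprimeTo n))
ℕ→ℚ-mkℚ n = ℚₚ.normalize-coprime (coprime-sym (1-coprimeTo n))

-- On two mkℚ's, ℚ's _+_ and _*_ unfold to a single unnormalised fraction over 1 * 1.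
ℕ→ℚ-+ : ∀ m n → ℕ→ℚ (m ℕ.+ n) ≡ ℕ→ℚ m + ℕ→ℚ n
ℕ→ℚ-+ m n = trans (ℚₚ./-cong {ℤ.+ (m ℕ.+ n)} {1} numerator refl)
                  (sym (cong₂ _+_ (ℕ→ℚ-mkℚ m) (ℕ→ℚ-mkℚ n)))
  where
  numerator : ℤ.+ (m ℕ.+ n) ≡ ℤ.+ m ℤ.* ℤ.+ 1 ℤ.+ ℤ.+ n ℤ.* ℤ.+ 1
  numerator = trans (ℤₚ.pos-+ m n)
                    (sym (cong₂ ℤ._+_ (ℤₚ.*-identityʳ (ℤ.+ m)) (ℤₚ.*-identityʳ (ℤ.+ n))))

ℕ→ℚ-* : ∀ m n → ℕ→ℚ (m ℕ.* n) ≡ ℕ→ℚ m * ℕ→ℚ n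
ℕ→ℚ-* m n = trans (ℚₚ./-cong {ℤ.+ (m ℕ.* n)} {1} (ℤₚ.pos-* m n) refl)
                  (sym (cong₂ _*_ (ℕ→ℚ-mkℚ m) (ℕ→ℚ-mkℚ n)))

ℕ→ℚ-Σ : ∀ {A : Set} (g : A → ℕ) xs → ℚΣ.Σ (ℕ→ℚ ∘ g) xs ≡ ℕ→ℚ (ℕΣ.Σ g xs)
ℕ→ℚ-Σ g []       = refl
ℕ→ℚ-Σ g (x ∷ xs) = trans (cong (_+_ (ℕ→ℚ (g x))) (ℕ→ℚ-Σ g xs)) (sym (ℕ→ℚ-+ (g x) _))

-- z / suc d is by definition fromℚᵘ (mkℚᵘ z d).
/-≡-ℕ→ℚ : ∀ z D r .{{_ : ℕ.NonZero D}} → z ≡ ℤ.+ (r ℕ.* D) → z / D ≡ ℕ→ℚ r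
/-≡-ℕ→ℚ z (suc d) r refl = ℚₚ.fromℚᵘ-cong {mkℚᵘ (ℤ.+ (r ℕ.* suc d)) d} {mkℚᵘ (ℤ.+ r) 0}
  (*≡* (trans (ℤₚ.*-identityʳ _) (ℤₚ.pos-* r (suc d))))

powPred-*-ℕ→ℚ : ∀ w .{{_ : ℕ.NonZero w}} k → powPred w k * ℕ→ℚ w ≡ ℕ→ℚ (w ℕ.^ k)
powPred-*-ℕ→ℚ (suc d) zero =
  trans (cong₂ _*_ (ℚₚ.normalize-coprime (1-coprimeTo (suc d))) (ℕ→ℚ-mkℚ (suc d)))
        (/-≡-ℕ→ℚ (ℤ.+ 1 ℤ.* ℤ.+ suc d) (suc d ℕ.* 1) 1
          (trans (ℤₚ.*-identityˡ (ℤ.+ suc d))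
                 (cong ℤ.+_ (sym (trans (ℕₚ.*-identityˡ _) (ℕₚ.*-identityʳ (suc d)))))))
powPred-*-ℕ→ℚ w (suc k) =
  trans (sym (ℕ→ℚ-* (w ℕ.^ k) w)) (cong ℕ→ℚ (ℕₚ.*-comm (w ℕ.^ k) w))

*-ℕ→ℚ-cancelʳ : ∀ {p q} w .{{_ : ℕ.NonZero w}} → p * ℕ→ℚ w ≡ q * ℕ→ℚ w → p ≡ q
*-ℕ→ℚ-cancelʳ {p} {q} w pw≡qw =
  trans (sym (divide-back p)) (trans (cong (_* powPred w 0) pw≡qw) (divide-back q))
  where
  divide-back : ∀ r → r * ℕ→ℚ w * powPred w 0 ≡ r
  divide-back r = begin
    r * ℕ→ℚ w * powPred w 0     ≡⟨ ℚₚ.*-assoc r (ℕ→ℚ w) (powPred w 0) ⟩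
    r * (ℕ→ℚ w * powPred w 0)   ≡⟨ cong (r *_) (ℚₚ.*-comm (ℕ→ℚ w) (powPred w 0)) ⟩
    r * (powPred w 0 * ℕ→ℚ w)   ≡⟨ cong (r *_) (powPred-*-ℕ→ℚ w 0) ⟩
    r * 1ℚ                      ≡⟨ ℚₚ.*-identityʳ r ⟩
    r                           ∎
    where open ≡.≡-Reasoning

C*factorials≡! : ∀ {n k} → k ℕ.≤ n → (n C k) ℕ.* (k ! ℕ.* (n ∸ k) !) ≡ n !
C*factorials≡! {n} {k} k≤n = trans (cong (ℕ._* (k ! ℕ.* (n ∸ k) !)) (nCk≡n!/k![n-k]! k≤n))
  (m/n*n≡m {{ℕₚ.m*n≢0 (k !) ((n ∸ k) !) {{k ℕₚ.!≢0}} {{(n ∸ k) ℕₚ.!≢0}}}} (k![n∸k]!∣n! k≤n))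

multinomial≡C*C : ∀ {n k l} → k ℕ.≤ n → l ℕ.≤ n ∸ k →
  multinomial n k l (n ∸ k ∸ l) ≡ ℕ→ℚ ((n C k) ℕ.* ((n ∸ k) C l))
multinomial≡C*C {n} {k} {l} k≤n l≤n∸k =
  /-≡-ℕ→ℚ (ℤ.+ (n !)) ((k ! ℕ.* l !) ℕ.* m !) (C₁ ℕ.* C₂)
    {{ℕₚ.m*n≢0 _ _ {{ℕₚ.m*n≢0 _ _ {{k ℕₚ.!≢0}} {{l ℕₚ.!≢0}}}} {{m ℕₚ.!≢0}}}}
    (cong ℤ.+_ (begin
      n !                                            ≡⟨ C*factorials≡! k≤n ⟨
      C₁ ℕ.* (k ! ℕ.* (n ∸ k) !)                     ≡⟨ cong (λ x → C₁ ℕ.* (k ! ℕ.* x)) (C*factorials≡! l≤n∸k) ⟨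
      C₁ ℕ.* (k ! ℕ.* (C₂ ℕ.* (l ! ℕ.* m !)))        ≡⟨ regroup C₁ C₂ (k !) (l !) (m !) ⟩
      (C₁ ℕ.* C₂) ℕ.* ((k ! ℕ.* l !) ℕ.* m !)        ∎))
  where
  open ≡.≡-Reasoning
  m = n ∸ k ∸ l
  C₁ = n C k
  C₂ = (n ∸ k) C l
  regroup : ∀ c₁ c₂ x y z → c₁ ℕ.* (x ℕ.* (c₂ ℕ.* (y ℕ.* z))) ≡ (c₁ ℕ.* c₂) ℕ.* ((x ℕ.* y) ℕ.* z)
  regroup c₁ c₂ x y z = solve (c₁ ∷ c₂ ∷ x ∷ y ∷ z ∷ [])
    where open import Data.Nat.Tactic.RingSolver using (solve)

sumTriples-cong : ∀ n (F G : ℕ → ℕ → ℕ → ℚ) →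
  (∀ {k l} → k ℕ.≤ n → l ℕ.≤ n ∸ k → F k l (n ∸ k ∸ l) ≡ G k l (n ∸ k ∸ l)) → sumTriples n F ≡ sumTriples n G
sumTriples-cong n F G F≗G =
  ℚΣ.Σ-cong-upTo (suc n) λ {k} k<1+n → ℚΣ.Σ-cong-upTo (suc (n ∸ k)) λ l<1+n∸k →
    F≗G (ℕ.s≤s⁻¹ k<1+n) (ℕ.s≤s⁻¹ l<1+n∸k)

sumTriples-*ʳ : ∀ n F q → sumTriples n F * q ≡ sumTriples n (λ k l m → F k l m * q)
sumTriples-*ʳ n F q =
  trans (sym (ℚΣ.Σ-*ʳ q (λ k → ℚΣ.Σ (row k) (upTo (suc (n ∸ k)))) (upTo (suc n))))
        (ℚΣ.Σ-cong (upTo (suc n)) λ k → sym (ℚΣ.Σ-*ʳ q (row k) (upTo (suc (n ∸ k)))))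
  where
  row : ℕ → ℕ → ℚ
  row k l = F k l (n ∸ k ∸ l)

sumTriples-multinomial : ∀ n (a b c : ℕ → ℕ) →
  sumTriples n (λ k l m → multinomial n k l m * ℕ→ℚ (a k) * ℕ→ℚ (b l) * ℕ→ℚ (c m)) ≡ ℕ→ℚ ((a ⋆ b ⋆ c) n)
sumTriples-multinomial n a b c = begin
  sumTriples n F                              ≡⟨ sumTriples-cong n F G term ⟩
  sumTriples n G                              ≡⟨ ℚΣ.Σ-cong (upTo (suc n)) inner ⟩
  ℚΣ.Σ (ℕ→ℚ ∘ outer) (upTo (suc n))           ≡⟨ ℕ→ℚ-Σ outer (upTo (suc n)) ⟩
  ℕ→ℚ ((a ⋆ b ⋆ c) n)                         ∎
  where
  open ≡.≡-Reasoning
  F G : ℕ → ℕ → ℕ → ℚ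
  F k l m = multinomial n k l m * ℕ→ℚ (a k) * ℕ→ℚ (b l) * ℕ→ℚ (c m)
  G k l m = ℕ→ℚ ((n C k) ℕ.* a k ℕ.* (((n ∸ k) C l) ℕ.* b l ℕ.* c m))
  outer : ℕ → ℕ
  outer k = (n C k) ℕ.* a k ℕ.* (b ⋆ c) (n ∸ k)
  term : ∀ {k l} → k ℕ.≤ n → l ℕ.≤ n ∸ k → F k l (n ∸ k ∸ l) ≡ G k l (n ∸ k ∸ l)
  term {k} {l} k≤n l≤n∸k = begin
    multinomial n k l m * ℕ→ℚ (a k) * ℕ→ℚ (b l) * ℕ→ℚ (c m)
      ≡⟨ cong (λ x → x * ℕ→ℚ (a k) * ℕ→ℚ (b l) * ℕ→ℚ (c m)) (multinomial≡C*C k≤n l≤n∸k) ⟩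
    ℕ→ℚ (C₁ ℕ.* C₂) * ℕ→ℚ (a k) * ℕ→ℚ (b l) * ℕ→ℚ (c m)
      ≡⟨ cong (λ x → x * ℕ→ℚ (b l) * ℕ→ℚ (c m)) (ℕ→ℚ-* (C₁ ℕ.* C₂) (a k)) ⟨
    ℕ→ℚ (C₁ ℕ.* C₂ ℕ.* a k) * ℕ→ℚ (b l) * ℕ→ℚ (c m)
      ≡⟨ cong (_* ℕ→ℚ (c m)) (ℕ→ℚ-* (C₁ ℕ.* C₂ ℕ.* a k) (b l)) ⟨
    ℕ→ℚ (C₁ ℕ.* C₂ ℕ.* a k ℕ.* b l) * ℕ→ℚ (c m)
      ≡⟨ ℕ→ℚ-* (C₁ ℕ.* C₂ ℕ.* a k ℕ.* b l) (c m) ⟨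
    ℕ→ℚ (C₁ ℕ.* C₂ ℕ.* a k ℕ.* b l ℕ.* c m)
      ≡⟨ cong ℕ→ℚ (regroup C₁ C₂ (a k) (b l) (c m)) ⟩
    ℕ→ℚ (C₁ ℕ.* a k ℕ.* (C₂ ℕ.* b l ℕ.* c m)) ∎
    where
    m = n ∸ k ∸ l
    C₁ = n C k
    C₂ = (n ∸ k) C l
    regroup : ∀ c₁ c₂ x y z → c₁ ℕ.* c₂ ℕ.* x ℕ.* y ℕ.* z ≡ c₁ ℕ.* x ℕ.* (c₂ ℕ.* y ℕ.* z)
    regroup c₁ c₂ x y z = solve (c₁ ∷ c₂ ∷ x ∷ y ∷ z ∷ [])
      where open import Data.Nat.Tactic.RingSolver using (solve)
  inner : ∀ k → ℚΣ.Σ (λ l → G k l (n ∸ k ∸ l)) (upTo (suc (n ∸ k))) ≡ ℕ→ℚ (outer k)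
  inner k = trans (ℕ→ℚ-Σ (λ l → (n C k) ℕ.* a k ℕ.* bc l) (upTo (suc (n ∸ k))))
                  (cong ℕ→ℚ (ℕΣ.Σ-*ˡ ((n C k) ℕ.* a k) bc (upTo (suc (n ∸ k)))))
    where
    bc : ℕ → ℕ
    bc l = ((n ∸ k) C l) ℕ.* b l ℕ.* c (n ∸ k ∸ l)

sumTriples-powPred : ∀ n (a b c : ℕ → ℕ) P Q R .{{_ : ℕ.NonZero P}} .{{_ : ℕ.NonZero Q}} .{{_ : ℕ.NonZero R}} →
  sumTriples n (λ k l m → multinomial n k l m * ℕ→ℚ (a k) * ℕ→ℚ (b l) * ℕ→ℚ (c m)
                            * powPred P k * powPred Q l * powPred R m) * ℕ→ℚ (P ℕ.* Q ℕ.* R)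
    ≡ ℕ→ℚ (((λ k → a k ℕ.* P ℕ.^ k) ⋆ (λ k → b k ℕ.* Q ℕ.^ k) ⋆ (λ k → c k ℕ.* R ℕ.^ k)) n)
sumTriples-powPred n a b c P Q R = begin
  sumTriples n F * PQR                    ≡⟨ sumTriples-*ʳ n F PQR ⟩
  sumTriples n F·PQR                      ≡⟨ sumTriples-cong n F·PQR F′ (λ {k} {l} _ _ → absorb k l (n ∸ k ∸ l)) ⟩
  sumTriples n F′                         ≡⟨ sumTriples-multinomial n a′ b′ c′ ⟩
  ℕ→ℚ ((a′ ⋆ b′ ⋆ c′) n)                  ∎
  where
  open ≡.≡-Reasoning
  PQR = ℕ→ℚ (P ℕ.* Q ℕ.* R)
  a′ b′ c′ : ℕ → ℕ
  a′ k = a k ℕ.* P ℕ.^ k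
  b′ k = b k ℕ.* Q ℕ.^ k
  c′ k = c k ℕ.* R ℕ.^ k
  F F′ : ℕ → ℕ → ℕ → ℚ
  F k l m = multinomial n k l m * ℕ→ℚ (a k) * ℕ→ℚ (b l) * ℕ→ℚ (c m)
              * powPred P k * powPred Q l * powPred R m
  F′ k l m = multinomial n k l m * ℕ→ℚ (a′ k) * ℕ→ℚ (b′ l) * ℕ→ℚ (c′ m)
  F·PQR : ℕ → ℕ → ℕ → ℚ
  F·PQR k l m = F k l m * PQR
  scale : ∀ x W .{{_ : ℕ.NonZero W}} k → ℕ→ℚ x * (powPred W k * ℕ→ℚ W) ≡ ℕ→ℚ (x ℕ.* W ℕ.^ k)
  scale x W k = trans (cong (ℕ→ℚ x *_) (powPred-*-ℕ→ℚ W k)) (sym (ℕ→ℚ-* x (W ℕ.^ k)))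
  regroup : ∀ μ x y z u v w U V W →
    μ * x * y * z * u * v * w * (U * V * W) ≡ μ * (x * (u * U)) * (y * (v * V)) * (z * (w * W))
  regroup = solve 10 (λ μ x y z u v w U V W →
      μ :* x :* y :* z :* u :* v :* w :* (U :* V :* W)
        := μ :* (x :* (u :* U)) :* (y :* (v :* V)) :* (z :* (w :* W))) refl
    where open +-*-Solver
  absorb : ∀ k l m → F·PQR k l m ≡ F′ k l m
  absorb k l m = begin
    F·PQR k l m
      ≡⟨ cong (F k l m *_) (trans (ℕ→ℚ-* (P ℕ.* Q) R) (cong (_* ℕ→ℚ R) (ℕ→ℚ-* P Q))) ⟩
    F k l m * (ℕ→ℚ P * ℕ→ℚ Q * ℕ→ℚ R)
      ≡⟨ regroup μ (ℕ→ℚ (a k)) (ℕ→ℚ (b l)) (ℕ→ℚ (c m)) (powPred P k) (powPred Q l) (powPred R m)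
                 (ℕ→ℚ P) (ℕ→ℚ Q) (ℕ→ℚ R) ⟩
    μ * (ℕ→ℚ (a k) * (powPred P k * ℕ→ℚ P)) * (ℕ→ℚ (b l) * (powPred Q l * ℕ→ℚ Q))
      * (ℕ→ℚ (c m) * (powPred R m * ℕ→ℚ R))
      ≡⟨ cong₂ _*_ (cong₂ _*_ (cong (μ *_) (scale (a k) P k)) (scale (b l) Q l)) (scale (c m) R m) ⟩
    F′ k l m ∎
    where μ = multinomial n k l m

theorem17 : (w₁ w₂ w₃ : ℕ) → .{{_ : NonZero w₁}} → .{{_ : NonZero w₂}} → .{{_ : NonZero w₃}} → (n : ℕ) →
    sumTriples n (λ k l m → multinomial n k l m * ℕ→ℚ (S k (w₁ ∸ 1)) * ℕ→ℚ (S l (w₂ ∸ 1)) * ℕ→ℚ (S m (w₃ ∸ 1))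
                              * powPred w₃ k * powPred w₁ l * powPred w₂ m)
    ≡ sumTriples n (λ k l m → multinomial n k l m * ℕ→ℚ (S k (w₁ ∸ 1)) * ℕ→ℚ (S l (w₃ ∸ 1)) * ℕ→ℚ (S m (w₂ ∸ 1))
                              * powPred w₂ k * powPred w₁ l * powPred w₃ m)
theorem17 w₁@(suc _) w₂@(suc _) w₃@(suc _) n = *-ℕ→ℚ-cancelʳ (w₃ ℕ.* w₁ ℕ.* w₂) (begin
  sumTriples n F * ℕ→ℚ (w₃ ℕ.* w₁ ℕ.* w₂) ≡⟨ sumTriples-powPred n (S′ w₁) (S′ w₂) (S′ w₃) w₃ w₁ w₂ ⟩
  _                                       ≡⟨ cong ℕ→ℚ (progressions-⋆ w₁ w₂ w₃ n) ⟩
  _                                       ≡⟨ sumTriples-powPred n (S′ w₁) (S′ w₃) (S′ w₂) w₂ w₁ w₃ ⟨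
  sumTriples n G * ℕ→ℚ (w₂ ℕ.* w₁ ℕ.* w₃) ≡⟨ cong (λ W → sumTriples n G * ℕ→ℚ W) (xy∙z≈zy∙x w₂ w₁ w₃) ⟩
  sumTriples n G * ℕ→ℚ (w₃ ℕ.* w₁ ℕ.* w₂) ∎)
  where
  open ≡.≡-Reasoning
  open import Algebra.Properties.CommutativeSemigroup ℕₚ.*-commutativeSemigroup using (xy∙z≈zy∙x)
  S′ : ℕ → ℕ → ℕ
  S′ w k = S k (w ∸ 1)
  F G : ℕ → ℕ → ℕ → ℚ
  F k l m = multinomial n k l m * ℕ→ℚ (S′ w₁ k) * ℕ→ℚ (S′ w₂ l) * ℕ→ℚ (S′ w₃ m)
              * powPred w₃ k * powPred w₁ l * powPred w₂ m
  G k l m = multinomial n k l m * ℕ→ℚ (S′ w₁ k) * ℕ→ℚ (S′ w₃ l) * ℕ→ℚ (S′ w₂ m)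
              * powPred w₂ k * powPred w₁ l * powPred w₃ m
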